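{- For every simply typed $\lambda$-term $M$: (1) both $\widehat{M}^{\mathrm n}$ and $\widehat{M}^{\mathrm v}$ are normal forms with respect to the control rules (no control rule applies to them); (2) by sequences of control rules, $*;M^{\mathrm n}\to^*\widehat{M}^{\mathrm n}$ and $M^{\mathrm v}\,*\to^*\widehat{M}^{\mathrm v}$.
   Context: ptq-calculus: p-variables (identified with $\lambda$-variables), a t-variable $k$, a constant $*$; p-terms $p::=x\mid\lambda\langle x,k\rangle.u\mid\lambda k.u$; t-terms $t::=*\mid k\mid\langle p,t\rangle\mid\lambda x.u$; q-terms $q::=\overline{\lambda}k.u$; e-terms $u::=t;p\mid q\,t$; binders $\lambda\langle x,k\rangle$ (binds $x,k$), $\lambda k,\overline\lambda k$ (bind $k$), $\lambda x$ (binds $x$); terms modulo $\alpha$-conversion. t-closed means no free t-variable; for $u$ with $k$ free, $u_*:=u[*/k]$. Reduction (on t-closed e-terms, only at top level): $*;\lambda k.u\to u[*/k]$; $\langle p,t_*\rangle;\lambda k.u\to u[\langle p,t_*\rangle/k]$; $\langle p,t_*\rangle;\lambda\langle x,k\rangle.u\to u[p/x,t_*/k]$ ($\beta$-rule); $(\lambda x.u_*);p\to u_*[p/x]$; $(\overline\lambda k.u)\,t_*\to u[t_*/k]$. All rules except the $\beta$-rule are control rules. Composition: $t_*\cdot a_*:=a_*[t_*/*]$ for t-closed t-terms $t_*$ and t-closed t-/e-terms $a_*$. $\lambda$-terms: a value $V$ is a variable or an abstraction. Translations: $x^{\mathrm n}=x$, $(\lambda x.M)^{\mathrm n}=\lambda\langle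 x,k\rangle.k;M^{\mathrm n}$, $(MN)^{\mathrm n}=\lambda k.\langle N^{\mathrm n},k\rangle;M^{\mathrm n}$; $x^{\mathrm v}=\overline\lambda k.k;x$, $(\lambda x.M)^{\mathrm v}=\overline\lambda k.k;(\lambda\langle x,k\rangle.M^{\mathrm v}k)$, $(MN)^{\mathrm v}=\overline\lambda k.N^{\mathrm v}(\lambda x.M^{\mathrm v}\langle x,k\rangle)$. Auxiliary maps on values: $\overline{x}^{\mathrm n}=x$, $\overline{\lambda x.M}^{\mathrm n}=\lambda\langle x,k\rangle.k;M^{\mathrm n}$; $\overline{x}^{\mathrm v}=x$, $\overline{\lambda x.M}^{\mathrm v}=\lambda\langle x,k\rangle.M^{\mathrm v}k$. Translations into e-terms: $\widehat V^{\mathrm n}=*;\overline V^{\mathrm n}$, $\widehat{MN}^{\mathrm n}=\langle N^{\mathrm n},*\rangle\cdot\widehat M^{\mathrm n}$; $\widehat V^{\mathrm v}=*;\overline V^{\mathrm v}$, $\widehat{MV}^{\mathrm v}=\langle\overline V^{\mathrm v},*\rangle\cdot\widehat M^{\mathrm v}$ for $V$ a value, $\widehat{MN}^{\mathrm v}=(\lambda x.M^{\mathrm v}\langle x,*\rangle)\cdot\widehat N^{\mathrm v}$ for $N$ not a value ($x$ fresh). -}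

module Defs where

open import Data.Nat using (ℕ; zero; suc)
open import Data.Bool using (Bool; true; false; _∨_)
open import Data.List using (List; []; _∷_)
open import Data.Product using (∃; _×_)
open import Relation.Binary.PropositionalEquality using (_≡_)
open import Relation.Nullary using (¬_)
open import Relation.Binary.Construct.Closure.ReflexiveTransitive using (Star)

-- ptq-calculus, terms modulo α-conversion.
-- p-variables (= λ-variables) are de Bruijn indices (ℕ).
-- There is a single t-variable k; every k-binder (λ⟨x,k⟩, λk, λ̄k)
-- rebinds it, so a free occurrence of k refers to the nearest such
-- binder and needs no index.

mutual
  -- p-terms  p ::= x | λ⟨x,k⟩.u | λk.u
  data P : Set where
    var   : ℕ → P
    lamxk : E → P
    lamk  : E → P

  -- t-terms  t ::= * | k | ⟨p,t⟩ | λx.u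
  data T : Set where
    star : T
    kvar : T
    pair : P → T → T
    lamx : E → T

  -- q-terms  q ::= λ̄k.u
  data Q : Set where
    lbar : E → Q

  -- e-terms  u ::= t;p | q t
  data E : Set where
    semi : T → P → E
    app  : Q → T → E

mutual
  fkP : P → Bool
  fkP (var _)   = false
  fkP (lamxk _) = false
  fkP (lamk _)  = false

  fkT : T → Bool
  fkT star       = false
  fkT kvar       = true
  fkT (pair p t) = fkP p ∨ fkT t
  fkT (lamx u)   = fkE u

  fkQ : Q → Bool
  fkQ (lbar _) = false

  fkE : E → Bool
  fkE (semi t p) = fkT t ∨ fkP p
  fkE (app q t)  = fkQ q ∨ fkT t

TClosedT : T → Set
TClosedT t = fkT t ≡ false

TClosedE : E → Set
TClosedE u = fkE u ≡ false

ext : (ℕ → ℕ) → ℕ → ℕ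
ext ρ zero    = zero
ext ρ (suc i) = suc (ρ i)

mutual
  renP : (ℕ → ℕ) → P → P
  renP ρ (var i)   = var (ρ i)
  renP ρ (lamxk u) = lamxk (renE (ext ρ) u)
  renP ρ (lamk u)  = lamk (renE ρ u)

  renT : (ℕ → ℕ) → T → T
  renT ρ star       = star
  renT ρ kvar       = kvar
  renT ρ (pair p t) = pair (renP ρ p) (renT ρ t)
  renT ρ (lamx u)   = lamx (renE (ext ρ) u)

  renQ : (ℕ → ℕ) → Q → Q
  renQ ρ (lbar u) = lbar (renE ρ u)

  renE : (ℕ → ℕ) → E → E
  renE ρ (semi t p) = semi (renT ρ t) (renP ρ p)
  renE ρ (app q t)  = app (renQ ρ q) (renT ρ t)

shiftP : P → P
shiftP = renP suc

shiftT : T → T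
shiftT = renT suc

shiftQ : Q → Q
shiftQ = renQ suc

-- Simultaneous substitution of p-terms for p-variables.
-- (p-terms never contain a free k, so no capture of k can occur.)

exts : (ℕ → P) → ℕ → P
exts σ zero    = var zero
exts σ (suc i) = shiftP (σ i)

mutual
  subP : (ℕ → P) → P → P
  subP σ (var i)   = σ i
  subP σ (lamxk u) = lamxk (subE (exts σ) u)
  subP σ (lamk u)  = lamk (subE σ u)

  subT : (ℕ → P) → T → T
  subT σ star       = star
  subT σ kvar       = kvar
  subT σ (pair p t) = pair (subP σ p) (subT σ t)
  subT σ (lamx u)   = lamx (subE (exts σ) u)

  subQ : (ℕ → P) → Q → Q
  subQ σ (lbar u) = lbar (subE σ u)

  subE : (ℕ → P) → E → E
  subE σ (semi t p) = semi (subT σ t) (subP σ p)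
  subE σ (app q t)  = app (subQ σ q) (subT σ t)

-- u[p/x]  (x = de Bruijn index 0)
single : P → ℕ → P
single p zero    = p
single p (suc i) = var i

_[_/x] : E → P → E
u [ p /x] = subE (single p) u

mutual
  kP : T → P → P
  kP s (var i)   = var i
  kP s (lamxk u) = lamxk u
  kP s (lamk u)  = lamk u

  kT : T → T → T
  kT s star       = star
  kT s kvar       = s
  kT s (pair p t) = pair (kP s p) (kT s t)
  kT s (lamx u)   = lamx (kE (shiftT s) u)

  kQ : T → Q → Q
  kQ s (lbar u) = lbar u

  kE : T → E → E
  kE s (semi t p) = semi (kT s t) (kP s p)
  kE s (app q t)  = app (kQ s q) (kT s t)

_[_/k] : E → T → E
u [ t /k] = kE t u

mutual
  sP : T → P → P
  sP s (var i)   = var i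
  sP s (lamxk u) = lamxk (sE (shiftT s) u)
  sP s (lamk u)  = lamk (sE s u)

  sT : T → T → T
  sT s star       = s
  sT s kvar       = kvar
  sT s (pair p t) = pair (sP s p) (sT s t)
  sT s (lamx u)   = lamx (sE (shiftT s) u)

  sQ : T → Q → Q
  sQ s (lbar u) = lbar (sE s u)

  sE : T → E → E
  sE s (semi t p) = semi (sT s t) (sP s p)
  sE s (app q t)  = app (sQ s q) (sT s t)

_·_ : T → E → E
t · a = sE t a

-- Reduction: on t-closed e-terms, top level only.
-- Control rules (all rules except β):

data _⟶ᶜ_ : E → E → Set where
  *-λk   : ∀ u → TClosedE (semi star (lamk u)) →
           semi star (lamk u) ⟶ᶜ (u [ star /k])
  ⟨⟩-λk  : ∀ p t u → TClosedE (semi (pair p t) (lamk u)) →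
           semi (pair p t) (lamk u) ⟶ᶜ (u [ pair p t /k])
  λx-p   : ∀ u p → TClosedE (semi (lamx u) p) →
           semi (lamx u) p ⟶ᶜ (u [ p /x])
  λ̄k-t   : ∀ u t → TClosedE (app (lbar u) t) →
           app (lbar u) t ⟶ᶜ (u [ t /k])

data _⟶β_ : E → E → Set where
  β : ∀ p t u → TClosedE (semi (pair p t) (lamxk u)) →
      semi (pair p t) (lamxk u) ⟶β ((u [ t /k]) [ p /x])

_⟶ᶜ*_ : E → E → Set
_⟶ᶜ*_ = Star _⟶ᶜ_

ControlNormal : E → Set
ControlNormal u = ∀ v → ¬ (u ⟶ᶜ v)

data Λ : Set where
  ` : ℕ → Λ
  ƛ : Λ → Λ
  _∙_ : Λ → Λ → Λ

data Value : Λ → Set where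
  v-var : ∀ i → Value (` i)
  v-lam : ∀ M → Value (ƛ M)

data Ty : Set where
  atom : ℕ → Ty
  _⇒_  : Ty → Ty → Ty

data _∋_∶_ : List Ty → ℕ → Ty → Set where
  here  : ∀ {Γ A} → (A ∷ Γ) ∋ zero ∶ A
  there : ∀ {Γ A B i} → Γ ∋ i ∶ A → (B ∷ Γ) ∋ suc i ∶ A

data _⊢_∶_ : List Ty → Λ → Ty → Set where
  ⊢var : ∀ {Γ i A} → Γ ∋ i ∶ A → Γ ⊢ ` i ∶ A
  ⊢lam : ∀ {Γ M A B} → (A ∷ Γ) ⊢ M ∶ B → Γ ⊢ ƛ M ∶ (A ⇒ B)
  ⊢app : ∀ {Γ M N A B} → Γ ⊢ M ∶ (A ⇒ B) → Γ ⊢ N ∶ A → Γ ⊢ M ∙ N ∶ B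

tr-n : Λ → P
tr-n (` i)   = var i
tr-n (ƛ M)   = lamxk (semi kvar (tr-n M))
tr-n (M ∙ N) = lamk (semi (pair (tr-n N) kvar) (tr-n M))

-- call-by-value  M ↦ M^v   (in (MN)^v, M^v is under the fresh λx)
tr-v : Λ → Q
tr-v (` i)   = lbar (semi kvar (var i))
tr-v (ƛ M)   = lbar (semi kvar (lamxk (app (tr-v M) kvar)))
tr-v (M ∙ N) = lbar (app (tr-v N) (lamx (app (shiftQ (tr-v M)) (pair (var zero) kvar))))

bar-n : (V : Λ) → Value V → P
bar-n (` i) (v-var .i) = var i
bar-n (ƛ M) (v-lam .M) = lamxk (semi kvar (tr-n M))

bar-v : (V : Λ) → Value V → P
bar-v (` i) (v-var .i) = var i
bar-v (ƛ M) (v-lam .M) = lamxk (app (tr-v M) kvar)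

hat-n : Λ → E
hat-n (` i)   = semi star (bar-n (` i) (v-var i))
hat-n (ƛ M)   = semi star (bar-n (ƛ M) (v-lam M))
hat-n (M ∙ N) = pair (tr-n N) star · hat-n M

hat-v : Λ → E
hat-v (` i)   = semi star (bar-v (` i) (v-var i))
hat-v (ƛ M)   = semi star (bar-v (ƛ M) (v-lam M))
hat-v (M ∙ ` i)   = pair (bar-v (` i) (v-var i)) star · hat-v M
hat-v (M ∙ ƛ N)   = pair (bar-v (ƛ N) (v-lam N)) star · hat-v M
hat-v (M ∙ (N₁ ∙ N₂)) =
  lamx (app (shiftQ (tr-v M)) (pair (var zero) star)) · hat-v (N₁ ∙ N₂)

module Submission where

open import Defs
open import Data.Product using (_×_; _,_)
open import Data.List using (List)
open import Data.Nat using (zero; suc)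
open import Data.Bool using (_∨_; false)
open import Function using (_∘_)
open import Relation.Binary.PropositionalEquality
  using (_≡_; refl; sym; trans; cong; cong₂; _≗_)
open import Relation.Binary.Construct.Closure.ReflexiveTransitive using (ε; _◅_)
open import Relation.Binary.Construct.Closure.ReflexiveTransitive.Properties
  using (module StarReasoning)

-- Both parts are proved for an arbitrary continuation s in place of *:
--   s ; M^n →* s · M̂^n   (s a stack * or ⟨p,t⟩)   and   M^v s →* s · M̂^v   (s t-closed),
-- by induction on M; the statement is the instance s = *, since * · u = u.
-- For the application case of M^v, the argument N either is a value, and one
-- more λx-step feeds it to M^v, or is itself an application, whose ^-translation
-- then absorbs the pending continuation λx.M^v⟨x,s⟩ by associativity of ·.
-- Every M̂ has the shape t;p with t ∈ {*, ⟨_,_⟩} and p ∈ {x, λ⟨x,k⟩.u}, which no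
-- control rule matches.

fkP-false : ∀ p → fkP p ≡ false
fkP-false (var _)   = refl
fkP-false (lamxk _) = refl
fkP-false (lamk _)  = refl

fkQ-false : ∀ q → fkQ q ≡ false
fkQ-false (lbar _) = refl

kP-identity : ∀ s p → kP s p ≡ p
kP-identity s (var _)   = refl
kP-identity s (lamxk _) = refl
kP-identity s (lamk _)  = refl

kQ-identity : ∀ s q → kQ s q ≡ q
kQ-identity s (lbar _) = refl

pair-tclosed : ∀ p t → TClosedT t → TClosedT (pair p t)
pair-tclosed p t closed rewrite fkP-false p = closed

semi-tclosed : ∀ t p → TClosedT t → TClosedE (semi t p)
semi-tclosed t p closed rewrite closed | fkP-false p = refl

app-tclosed : ∀ q t → TClosedT t → TClosedE (app q t)
app-tclosed q t closed rewrite fkQ-false q = closed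

mutual
  fkT-renT : ∀ ρ t → fkT (renT ρ t) ≡ fkT t
  fkT-renT ρ star       = refl
  fkT-renT ρ kvar       = refl
  fkT-renT ρ (pair p t) = cong₂ _∨_ (trans (fkP-false _) (sym (fkP-false p))) (fkT-renT ρ t)
  fkT-renT ρ (lamx u)   = fkE-renE (ext ρ) u

  fkE-renE : ∀ ρ u → fkE (renE ρ u) ≡ fkE u
  fkE-renE ρ (semi t p) = cong₂ _∨_ (fkT-renT ρ t) (trans (fkP-false _) (sym (fkP-false p)))
  fkE-renE ρ (app q t)  = cong₂ _∨_ (trans (fkQ-false _) (sym (fkQ-false q))) (fkT-renT ρ t)

ext-fusion : ∀ {ρ σ τ} → ρ ∘ σ ≗ τ → ext ρ ∘ ext σ ≗ ext τ
ext-fusion h zero    = refl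
ext-fusion h (suc i) = cong suc (h i)

mutual
  renP-fusion : ∀ {ρ σ τ} → ρ ∘ σ ≗ τ → ∀ p → renP ρ (renP σ p) ≡ renP τ p
  renP-fusion h (var i)   = cong var (h i)
  renP-fusion h (lamxk u) = cong lamxk (renE-fusion (ext-fusion h) u)
  renP-fusion h (lamk u)  = cong lamk (renE-fusion h u)

  renT-fusion : ∀ {ρ σ τ} → ρ ∘ σ ≗ τ → ∀ t → renT ρ (renT σ t) ≡ renT τ t
  renT-fusion h star       = refl
  renT-fusion h kvar       = refl
  renT-fusion h (pair p t) = cong₂ pair (renP-fusion h p) (renT-fusion h t)
  renT-fusion h (lamx u)   = cong lamx (renE-fusion (ext-fusion h) u)

  renQ-fusion : ∀ {ρ σ τ} → ρ ∘ σ ≗ τ → ∀ q → renQ ρ (renQ σ q) ≡ renQ τ q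
  renQ-fusion h (lbar u) = cong lbar (renE-fusion h u)

  renE-fusion : ∀ {ρ σ τ} → ρ ∘ σ ≗ τ → ∀ u → renE ρ (renE σ u) ≡ renE τ u
  renE-fusion h (semi t p) = cong₂ semi (renT-fusion h t) (renP-fusion h p)
  renE-fusion h (app q t)  = cong₂ app (renQ-fusion h q) (renT-fusion h t)

exts-cancel : ∀ {σ ρ} → σ ∘ ρ ≗ var → exts σ ∘ ext ρ ≗ var
exts-cancel h zero    = refl
exts-cancel h (suc i) = cong shiftP (h i)

mutual
  subP-renP-cancel : ∀ {σ ρ} → σ ∘ ρ ≗ var → ∀ p → subP σ (renP ρ p) ≡ p
  subP-renP-cancel h (var i)   = h i
  subP-renP-cancel h (lamxk u) = cong lamxk (subE-renE-cancel (exts-cancel h) u)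
  subP-renP-cancel h (lamk u)  = cong lamk (subE-renE-cancel h u)

  subT-renT-cancel : ∀ {σ ρ} → σ ∘ ρ ≗ var → ∀ t → subT σ (renT ρ t) ≡ t
  subT-renT-cancel h star       = refl
  subT-renT-cancel h kvar       = refl
  subT-renT-cancel h (pair p t) = cong₂ pair (subP-renP-cancel h p) (subT-renT-cancel h t)
  subT-renT-cancel h (lamx u)   = cong lamx (subE-renE-cancel (exts-cancel h) u)

  subQ-renQ-cancel : ∀ {σ ρ} → σ ∘ ρ ≗ var → ∀ q → subQ σ (renQ ρ q) ≡ q
  subQ-renQ-cancel h (lbar u) = cong lbar (subE-renE-cancel h u)

  subE-renE-cancel : ∀ {σ ρ} → σ ∘ ρ ≗ var → ∀ u → subE σ (renE ρ u) ≡ u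
  subE-renE-cancel h (semi t p) = cong₂ semi (subT-renT-cancel h t) (subP-renP-cancel h p)
  subE-renE-cancel h (app q t)  = cong₂ app (subQ-renQ-cancel h q) (subT-renT-cancel h t)

renT-shiftT : ∀ ρ s → renT (ext ρ) (shiftT s) ≡ shiftT (renT ρ s)
renT-shiftT ρ s = trans (renT-fusion (λ _ → refl) s) (sym (renT-fusion (λ _ → refl) s))

mutual
  renP-sP : ∀ ρ s p → renP ρ (sP s p) ≡ sP (renT ρ s) (renP ρ p)
  renP-sP ρ s (var i)   = refl
  renP-sP ρ s (lamxk u) = cong lamxk (renE-sE-shiftT ρ s u)
  renP-sP ρ s (lamk u)  = cong lamk (renE-sE ρ s u)

  renT-sT : ∀ ρ s t → renT ρ (sT s t) ≡ sT (renT ρ s) (renT ρ t)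
  renT-sT ρ s star       = refl
  renT-sT ρ s kvar       = refl
  renT-sT ρ s (pair p t) = cong₂ pair (renP-sP ρ s p) (renT-sT ρ s t)
  renT-sT ρ s (lamx u)   = cong lamx (renE-sE-shiftT ρ s u)

  renQ-sQ : ∀ ρ s q → renQ ρ (sQ s q) ≡ sQ (renT ρ s) (renQ ρ q)
  renQ-sQ ρ s (lbar u) = cong lbar (renE-sE ρ s u)

  renE-sE : ∀ ρ s u → renE ρ (sE s u) ≡ sE (renT ρ s) (renE ρ u)
  renE-sE ρ s (semi t p) = cong₂ semi (renT-sT ρ s t) (renP-sP ρ s p)
  renE-sE ρ s (app q t)  = cong₂ app (renQ-sQ ρ s q) (renT-sT ρ s t)

  renE-sE-shiftT : ∀ ρ s u →
    renE (ext ρ) (sE (shiftT s) u) ≡ sE (shiftT (renT ρ s)) (renE (ext ρ) u)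
  renE-sE-shiftT ρ s u =
    trans (renE-sE (ext ρ) (shiftT s) u) (cong (λ s′ → sE s′ (renE (ext ρ) u)) (renT-shiftT ρ s))

mutual
  sP-sP : ∀ s s′ p → sP s (sP s′ p) ≡ sP (sT s s′) p
  sP-sP s s′ (var i)   = refl
  sP-sP s s′ (lamxk u) = cong lamxk (sE-sE-shiftT s s′ u)
  sP-sP s s′ (lamk u)  = cong lamk (sE-sE s s′ u)

  sT-sT : ∀ s s′ t → sT s (sT s′ t) ≡ sT (sT s s′) t
  sT-sT s s′ star       = refl
  sT-sT s s′ kvar       = refl
  sT-sT s s′ (pair p t) = cong₂ pair (sP-sP s s′ p) (sT-sT s s′ t)
  sT-sT s s′ (lamx u)   = cong lamx (sE-sE-shiftT s s′ u)

  sQ-sQ : ∀ s s′ q → sQ s (sQ s′ q) ≡ sQ (sT s s′) q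
  sQ-sQ s s′ (lbar u) = cong lbar (sE-sE s s′ u)

  sE-sE : ∀ s s′ u → sE s (sE s′ u) ≡ sE (sT s s′) u
  sE-sE s s′ (semi t p) = cong₂ semi (sT-sT s s′ t) (sP-sP s s′ p)
  sE-sE s s′ (app q t)  = cong₂ app (sQ-sQ s s′ q) (sT-sT s s′ t)

  sE-sE-shiftT : ∀ s s′ u → sE (shiftT s) (sE (shiftT s′) u) ≡ sE (shiftT (sT s s′)) u
  sE-sE-shiftT s s′ u =
    trans (sE-sE (shiftT s) (shiftT s′) u) (cong (λ s″ → sE s″ u) (sym (renT-sT suc s s′)))

mutual
  sP-star : ∀ p → sP star p ≡ p
  sP-star (var i)   = refl
  sP-star (lamxk u) = cong lamxk (sE-star u)
  sP-star (lamk u)  = cong lamk (sE-star u)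

  sT-star : ∀ t → sT star t ≡ t
  sT-star star       = refl
  sT-star kvar       = refl
  sT-star (pair p t) = cong₂ pair (sP-star p) (sT-star t)
  sT-star (lamx u)   = cong lamx (sE-star u)

  sQ-star : ∀ q → sQ star q ≡ q
  sQ-star (lbar u) = cong lbar (sE-star u)

  sE-star : ∀ u → sE star u ≡ u
  sE-star (semi t p) = cong₂ semi (sT-star t) (sP-star p)
  sE-star (app q t)  = cong₂ app (sQ-star q) (sT-star t)

mutual
  data StarFreeP : P → Set where
    var   : ∀ i → StarFreeP (var i)
    lamxk : ∀ {u} → StarFreeE u → StarFreeP (lamxk u)
    lamk  : ∀ {u} → StarFreeE u → StarFreeP (lamk u)

  data StarFreeT : T → Set where
    kvar : StarFreeT kvar
    pair : ∀ {p t} → StarFreeP p → StarFreeT t → StarFreeT (pair p t)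
    lamx : ∀ {u} → StarFreeE u → StarFreeT (lamx u)

  data StarFreeQ : Q → Set where
    lbar : ∀ {u} → StarFreeE u → StarFreeQ (lbar u)

  data StarFreeE : E → Set where
    semi : ∀ {t p} → StarFreeT t → StarFreeP p → StarFreeE (semi t p)
    app  : ∀ {q t} → StarFreeQ q → StarFreeT t → StarFreeE (app q t)

mutual
  renP-starFree : ∀ ρ {p} → StarFreeP p → StarFreeP (renP ρ p)
  renP-starFree ρ (var i)   = var _
  renP-starFree ρ (lamxk h) = lamxk (renE-starFree (ext ρ) h)
  renP-starFree ρ (lamk h)  = lamk (renE-starFree ρ h)

  renT-starFree : ∀ ρ {t} → StarFreeT t → StarFreeT (renT ρ t)
  renT-starFree ρ kvar       = kvar
  renT-starFree ρ (pair a b) = pair (renP-starFree ρ a) (renT-starFree ρ b)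
  renT-starFree ρ (lamx h)   = lamx (renE-starFree (ext ρ) h)

  renQ-starFree : ∀ ρ {q} → StarFreeQ q → StarFreeQ (renQ ρ q)
  renQ-starFree ρ (lbar h) = lbar (renE-starFree ρ h)

  renE-starFree : ∀ ρ {u} → StarFreeE u → StarFreeE (renE ρ u)
  renE-starFree ρ (semi a b) = semi (renT-starFree ρ a) (renP-starFree ρ b)
  renE-starFree ρ (app a b)  = app (renQ-starFree ρ a) (renT-starFree ρ b)

mutual
  sP-starFree : ∀ s {p} → StarFreeP p → sP s p ≡ p
  sP-starFree s (var i)   = refl
  sP-starFree s (lamxk h) = cong lamxk (sE-starFree (shiftT s) h)
  sP-starFree s (lamk h)  = cong lamk (sE-starFree s h)

  sT-starFree : ∀ s {t} → StarFreeT t → sT s t ≡ t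
  sT-starFree s kvar       = refl
  sT-starFree s (pair a b) = cong₂ pair (sP-starFree s a) (sT-starFree s b)
  sT-starFree s (lamx h)   = cong lamx (sE-starFree (shiftT s) h)

  sQ-starFree : ∀ s {q} → StarFreeQ q → sQ s q ≡ q
  sQ-starFree s (lbar h) = cong lbar (sE-starFree s h)

  sE-starFree : ∀ s {u} → StarFreeE u → sE s u ≡ u
  sE-starFree s (semi a b) = cong₂ semi (sT-starFree s a) (sP-starFree s b)
  sE-starFree s (app a b)  = cong₂ app (sQ-starFree s a) (sT-starFree s b)

sE-sE-pair : ∀ s {p} → StarFreeP p → ∀ u → sE s (sE (pair p star) u) ≡ sE (pair p s) u
sE-sE-pair s {p} h u = trans (sE-sE s (pair p star) u) (cong (λ p′ → sE (pair p′ s) u) (sP-starFree s h))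

tr-n-starFree : ∀ M → StarFreeP (tr-n M)
tr-n-starFree (` i)   = var i
tr-n-starFree (ƛ M)   = lamxk (semi kvar (tr-n-starFree M))
tr-n-starFree (M ∙ N) = lamk (semi (pair (tr-n-starFree N) kvar) (tr-n-starFree M))

tr-v-starFree : ∀ M → StarFreeQ (tr-v M)
tr-v-starFree (` i)   = lbar (semi kvar (var i))
tr-v-starFree (ƛ M)   = lbar (semi kvar (lamxk (app (tr-v-starFree M) kvar)))
tr-v-starFree (M ∙ N) =
  lbar (app (tr-v-starFree N) (lamx (app (renQ-starFree suc (tr-v-starFree M)) (pair (var zero) kvar))))

bar-v-starFree : ∀ {V} (v : Value V) → StarFreeP (bar-v V v)
bar-v-starFree (v-var i) = var i
bar-v-starFree (v-lam M) = lamxk (app (tr-v-starFree M) kvar)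

data Stack : T → Set where
  star : Stack star
  pair : ∀ p t → Stack (pair p t)

data Passive : P → Set where
  var   : ∀ i → Passive (var i)
  lamxk : ∀ u → Passive (lamxk u)

data Canonical : E → Set where
  semi : ∀ {t p} → Stack t → Passive p → Canonical (semi t p)

data PairCanonical : E → Set where
  semi : ∀ {a b p} → Passive p → PairCanonical (semi (pair a b) p)

canonical-controlNormal : ∀ {u} → Canonical u → ControlNormal u
canonical-controlNormal (semi _ ()) _ (*-λk _ _)
canonical-controlNormal (semi _ ()) _ (⟨⟩-λk _ _ _ _)
canonical-controlNormal (semi () _) _ (λx-p _ _ _)

pairCanonical⇒canonical : ∀ {u} → PairCanonical u → Canonical u
pairCanonical⇒canonical (semi h) = semi (pair _ _) h

sP-passive : ∀ s {p} → Passive p → Passive (sP s p)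
sP-passive s (var i)   = var i
sP-passive s (lamxk u) = lamxk _

pair-·-canonical : ∀ a b {u} → Canonical u → PairCanonical (pair a b · u)
pair-·-canonical a b (semi star h)       = semi (sP-passive _ h)
pair-·-canonical a b (semi (pair _ _) h) = semi (sP-passive _ h)

·-pairCanonical : ∀ s {u} → PairCanonical u → PairCanonical (s · u)
·-pairCanonical s (semi h) = semi (sP-passive s h)

hat-n-canonical : ∀ M → Canonical (hat-n M)
hat-n-canonical (` i)   = semi star (var i)
hat-n-canonical (ƛ M)   = semi star (lamxk _)
hat-n-canonical (M ∙ N) = pairCanonical⇒canonical (pair-·-canonical _ _ (hat-n-canonical M))

mutual
  hat-v-canonical : ∀ M → Canonical (hat-v M)
  hat-v-canonical (` i)   = semi star (var i)
  hat-v-canonical (ƛ M)   = semi star (lamxk _)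
  hat-v-canonical (M ∙ N) = pairCanonical⇒canonical (hat-v-app-pairCanonical M N)

  hat-v-app-pairCanonical : ∀ M N → PairCanonical (hat-v (M ∙ N))
  hat-v-app-pairCanonical M (` i)     = pair-·-canonical _ _ (hat-v-canonical M)
  hat-v-app-pairCanonical M (ƛ N)     = pair-·-canonical _ _ (hat-v-canonical M)
  hat-v-app-pairCanonical M (N₁ ∙ N₂) = ·-pairCanonical _ (hat-v-app-pairCanonical N₁ N₂)

open StarReasoning _⟶ᶜ_

λk-step : ∀ {s} u → Stack s → TClosedT s → semi s (lamk u) ⟶ᶜ (u [ s /k])
λk-step u star       closed = *-λk u (semi-tclosed star (lamk u) closed)
λk-step u (pair p t) closed = ⟨⟩-λk p t u (semi-tclosed (pair p t) (lamk u) closed)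

λx-step : ∀ u p → TClosedT (lamx u) → semi (lamx u) p ⟶ᶜ (u [ p /x])
λx-step u p closed = λx-p u p (semi-tclosed (lamx u) p closed)

λ̄k-step : ∀ u s → TClosedT s → app (lbar u) s ⟶ᶜ (u [ s /k])
λ̄k-step u s closed = λ̄k-t u s (app-tclosed (lbar u) s closed)

tr-n-reduces : ∀ M s → Stack s → TClosedT s → semi s (tr-n M) ⟶ᶜ* (s · hat-n M)
tr-n-reduces (` i) _ _ _ = ε
tr-n-reduces (ƛ M) s _ _ = begin
  semi s (tr-n (ƛ M))  ≡⟨ cong (semi s) (sym (sP-starFree s (tr-n-starFree (ƛ M)))) ⟩
  s · hat-n (ƛ M)      ∎
tr-n-reduces (M ∙ N) s stack closed = begin
  semi s (tr-n (M ∙ N))                          ⟶⟨ λk-step _ stack closed ⟩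
  semi (pair (kP s (tr-n N)) s) (kP s (tr-n M))
    ≡⟨ cong₂ (λ p p′ → semi (pair p s) p′) (kP-identity s (tr-n N)) (kP-identity s (tr-n M)) ⟩
  semi (pair (tr-n N) s) (tr-n M)
    ⟶*⟨ tr-n-reduces M (pair (tr-n N) s) (pair _ _) (pair-tclosed (tr-n N) s closed) ⟩
  pair (tr-n N) s · hat-n M                      ≡⟨ sym (sE-sE-pair s (tr-n-starFree N) (hat-n M)) ⟩
  s · hat-n (M ∙ N)                              ∎

-- The continuation λx.M^v⟨x,k⟩ of (MN)^v, with s substituted for k.
argCont : Λ → T → T
argCont M s = lamx (app (shiftQ (tr-v M)) (pair (var zero) (shiftT s)))

argCont-tclosed : ∀ M s → TClosedT s → TClosedT (argCont M s)
argCont-tclosed M s closed =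
  app-tclosed _ (pair (var zero) (shiftT s))
    (pair-tclosed (var zero) (shiftT s) (trans (fkT-renT suc s) closed))

sT-argCont : ∀ s M → sT s (argCont M star) ≡ argCont M s
sT-argCont s M = cong (λ q → lamx (app q (pair (var zero) (shiftT s))))
                      (sQ-starFree (shiftT s) (renQ-starFree suc (tr-v-starFree M)))

tr-v-value-reduces : ∀ {V} (v : Value V) s → TClosedT s → app (tr-v V) s ⟶ᶜ* semi s (bar-v V v)
tr-v-value-reduces (v-var i) s closed = λ̄k-step _ s closed ◅ ε
tr-v-value-reduces (v-lam M) s closed = λ̄k-step _ s closed ◅ ε

·-hat-v-value : ∀ s {V} (v : Value V) → s · hat-v V ≡ semi s (bar-v V v)
·-hat-v-value s (v-var i) = refl
·-hat-v-value s (v-lam M) = cong (semi s) (sP-starFree s (bar-v-starFree (v-lam M)))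

hat-v-app-value : ∀ M {V} (v : Value V) → hat-v (M ∙ V) ≡ pair (bar-v V v) star · hat-v M
hat-v-app-value M (v-var i) = refl
hat-v-app-value M (v-lam N) = refl

tr-v-reduces-value : ∀ {V} (v : Value V) s → TClosedT s → app (tr-v V) s ⟶ᶜ* (s · hat-v V)
tr-v-reduces-value {V} v s closed = begin
  app (tr-v V) s       ⟶*⟨ tr-v-value-reduces v s closed ⟩
  semi s (bar-v V v)   ≡⟨ sym (·-hat-v-value s v) ⟩
  s · hat-v V          ∎

mutual
  tr-v-reduces : ∀ M s → TClosedT s → app (tr-v M) s ⟶ᶜ* (s · hat-v M)
  tr-v-reduces (` i) s closed = tr-v-reduces-value (v-var i) s closed
  tr-v-reduces (ƛ M) s closed = tr-v-reduces-value (v-lam M) s closed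
  tr-v-reduces (M ∙ N) s closed = begin
    app (tr-v (M ∙ N)) s                                  ⟶⟨ λ̄k-step _ s closed ⟩
    app (kQ s (tr-v N))
        (lamx (app (kQ (shiftT s) (shiftQ (tr-v M))) (pair (var zero) (shiftT s))))
      ≡⟨ cong₂ (λ q q′ → app q (lamx (app q′ (pair (var zero) (shiftT s)))))
               (kQ-identity s (tr-v N)) (kQ-identity (shiftT s) (shiftQ (tr-v M))) ⟩
    app (tr-v N) (argCont M s)                            ⟶*⟨ argument-reduces M N s closed ⟩
    s · hat-v (M ∙ N)                                     ∎

  argument-reduces : ∀ M N s → TClosedT s → app (tr-v N) (argCont M s) ⟶ᶜ* (s · hat-v (M ∙ N))
  argument-reduces M (` i) s closed = value-argument-reduces M (v-var i) s closed
  argument-reduces M (ƛ N) s closed = value-argument-reduces M (v-lam N) s closed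
  argument-reduces M (N₁ ∙ N₂) s closed = begin
    app (tr-v (N₁ ∙ N₂)) (argCont M s)
                                        ⟶*⟨ tr-v-reduces (N₁ ∙ N₂) (argCont M s) (argCont-tclosed M s closed) ⟩
    argCont M s · hat-v (N₁ ∙ N₂)       ≡⟨ cong (_· hat-v (N₁ ∙ N₂)) (sym (sT-argCont s M)) ⟩
    sT s (argCont M star) · hat-v (N₁ ∙ N₂)
                                        ≡⟨ sym (sE-sE s (argCont M star) (hat-v (N₁ ∙ N₂))) ⟩
    s · hat-v (M ∙ (N₁ ∙ N₂))           ∎

  value-argument-reduces : ∀ M {V} (v : Value V) s → TClosedT s →
                           app (tr-v V) (argCont M s) ⟶ᶜ* (s · hat-v (M ∙ V))
  value-argument-reduces M {V} v s closed = begin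
    app (tr-v V) (argCont M s)
      ⟶*⟨ tr-v-value-reduces v (argCont M s) (argCont-tclosed M s closed) ⟩
    semi (argCont M s) p              ⟶⟨ λx-step _ p (argCont-tclosed M s closed) ⟩
    app (subQ (single p) (shiftQ (tr-v M))) (pair p (subT (single p) (shiftT s)))
      ≡⟨ cong₂ (λ q t → app q (pair p t))
               (subQ-renQ-cancel (λ _ → refl) (tr-v M)) (subT-renT-cancel (λ _ → refl) s) ⟩
    app (tr-v M) (pair p s)           ⟶*⟨ tr-v-reduces M (pair p s) (pair-tclosed p s closed) ⟩
    pair p s · hat-v M                ≡⟨ sym (sE-sE-pair s (bar-v-starFree v) (hat-v M)) ⟩
    s · (pair p star · hat-v M)       ≡⟨ cong (s ·_) (sym (hat-v-app-value M v)) ⟩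
    s · hat-v (M ∙ V)                 ∎
    where p = bar-v V v

lemma5 : ∀ {Γ : List Ty} {M : Λ} {A : Ty} → Γ ⊢ M ∶ A →
    (ControlNormal (hat-n M) × ControlNormal (hat-v M)) ×
    ((semi star (tr-n M) ⟶ᶜ* hat-n M) × (app (tr-v M) star ⟶ᶜ* hat-v M))
lemma5 {M = M} _ =
  ( canonical-controlNormal (hat-n-canonical M)
  , canonical-controlNormal (hat-v-canonical M) ) ,
  ( (begin
       semi star (tr-n M)  ⟶*⟨ tr-n-reduces M star star refl ⟩
       star · hat-n M      ≡⟨ sE-star (hat-n M) ⟩
       hat-n M             ∎)
  , (begin
       app (tr-v M) star   ⟶*⟨ tr-v-reduces M star refl ⟩
       star · hat-v M      ≡⟨ sE-star (hat-v M) ⟩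
       hat-v M             ∎) )
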